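{- Let $\mathcal M=(W,\Sigma,V)$ be a pseudo-model, $\mathcal M{\downarrow}$ its inquisitive closure, and $s\subseteq W$ any information state. Then for every $\phi\in\mathsf{InqML}$: $\mathcal M{\downarrow},s\models\phi$ if and only if $\mathcal M,s\models\phi$.
   Context: Fix a set of propositional variables $(p_i)_{i\in I}$. A pseudo-model is a triple $\mathcal M=(W,\Sigma,V)$ where $W$ is a non-empty set (of worlds), $\Sigma\colon W\to\mathcal P(\mathcal P(W))\setminus\{\emptyset\}$ and $V\colon\{p_i:i\in I\}\to\mathcal P(W)$. Put $\sigma(w):=\bigcup\Sigma(w)$. Subsets $s\subseteq W$ are called information states. The inquisitive closure of $\mathcal M$ is $\mathcal M{\downarrow}=(W,\Sigma{\downarrow},V)$ with $\Sigma{\downarrow}(w)=\{t\subseteq W: t\subseteq s\text{ for some }s\in\Sigma(w)\}$. Formulae of $\mathsf{InqML}$ are given by $\phi::=p_i\mid\bot\mid(\phi\wedge\phi)\mid(\phi\to\phi)\mid(\phi\mathbin{\backslash\!/}\phi)\mid\Box\phi\mid\boxplus\phi$. Support semantics for $s\subseteq W$: $\mathcal M,s\models p_i$ iff $s\subseteq V(p_i)$; $\mathcal M,s\models\bot$ iff $s=\emptyset$; $\mathcal M,s\models\phi\wedge\psi$ iff both hold; $\mathcal M,s\models\phi\to\psi$ iff for all $t\subseteq s$, $\mathcal M,t\models\phi$ implies $\mathcal M,t\models\psi$; $\mathcal M,s\models\phi\mathbin{\backslash\!/}\psi$ iff $\mathcal M,s\models\phi$ or $\mathcal M,s\models\psi$;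 $\mathcal M,s\models\Box\phi$ iff $\mathcal M,\sigma(w)\models\phi$ for all $w\in s$; $\mathcal M,s\models\boxplus\phi$ iff $\mathcal M,t\models\phi$ for all $w\in s$ and all $t\in\Sigma(w)$. -}

module Defs where

open import Level using (Level; Lift; lift; 0ℓ) renaming (suc to lsuc)
open import Data.Product using (Σ-syntax; ∃; ∃-syntax; _×_; _,_)
open import Data.Sum using (_⊎_)
open import Data.Empty using (⊥)
open import Relation.Nullary using (¬_)

1ℓ : Level
1ℓ = lsuc 0ℓ

_⊆_ : ∀ {ℓ ℓ'} {W : Set} → (W → Set ℓ) → (W → Set ℓ') → Set (ℓ Level.⊔ ℓ')
s ⊆ t = ∀ w → s w → t w

-- Formulae of InqML over propositional variables indexed by I.
-- _⩖_ is inquisitive disjunction, □ is the box, ⊞ the window modality.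
data Form (I : Set) : Set where
  var  : I → Form I
  ⊥'   : Form I
  _∧'_ : Form I → Form I → Form I
  _⇒_  : Form I → Form I → Form I
  _⩖_  : Form I → Form I → Form I
  □_   : Form I → Form I
  ⊞_   : Form I → Form I

-- A pseudo-model (W, Σ, V).  Elements of Σ(w) are subsets of W
-- (predicates W → Set); membership in Σ(w) is Set₁-valued so that the
-- inquisitive closure is again a pseudo-model of the same type.
record PseudoModel (I : Set) : Set₂ where
  field
    W      : Set
    w₀     : W
    Σw     : W → (W → Set) → Set₁
    Σw-ne  : ∀ w → ∃[ s ] Σw w s
    V      : I → W → Set

  σ : W → W → Set₁
  σ w v = ∃[ s ] (Σw w s × s v)

open PseudoModel public

_↓ : ∀ {I} → PseudoModel I → PseudoModel I
M ↓ = record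
  { W     = W M
  ; w₀    = w₀ M
  ; Σw    = λ w t → ∃[ s ] (Σw M w s × (t ⊆ s))
  ; Σw-ne = λ w → let (s , h) = Σw-ne M w in s , (s , h , λ _ x → x)
  ; V     = V M
  }

↑ : {W : Set} → (W → Set) → W → Set₁
↑ t v = Lift 1ℓ (t v)

_,_⊨_ : ∀ {I} (M : PseudoModel I) → (W M → Set₁) → Form I → Set₂
M , s ⊨ var i    = Lift _ (s ⊆ V M i)
M , s ⊨ ⊥'       = Lift _ (∀ w → ¬ s w)
M , s ⊨ (φ ∧' ψ) = (M , s ⊨ φ) × (M , s ⊨ ψ)
M , s ⊨ (φ ⇒ ψ)  = ∀ (t : W M → Set₁) → t ⊆ s → M , t ⊨ φ → M , t ⊨ ψ
M , s ⊨ (φ ⩖ ψ)  = (M , s ⊨ φ) ⊎ (M , s ⊨ ψ)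
M , s ⊨ (□ φ)    = ∀ w → s w → M , σ M w ⊨ φ
M , s ⊨ (⊞ φ)    = ∀ w → s w → ∀ t → Σw M w t → M , ↑ t ⊨ φ

module Submission where

-- Support is persistent (downward closed in the state).  Closing Σ(w) under
-- subsets leaves σ(w) unchanged and only adds states lying below old ones, so
-- by persistence neither □ nor ⊞ notices the difference.  Since implication
-- quantifies over antecedents on both sides, the two directions are proved by
-- a simultaneous induction on the formula.

open import Defs
open import Function.Bundles using (_⇔_; mk⇔)
open import Level using (lift)
open import Data.Product using (_,_)
open import Data.Sum using (inj₁; inj₂)

⊆-refl : ∀ {ℓ} {W : Set} {s : W → Set ℓ} → s ⊆ s
⊆-refl _ x = x

⊆-trans : ∀ {ℓ₁ ℓ₂ ℓ₃} {W : Set} {s : W → Set ℓ₁} {t : W → Set ℓ₂} {u : W → Set ℓ₃}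
          → s ⊆ t → t ⊆ u → s ⊆ u
⊆-trans s⊆t t⊆u w sw = t⊆u w (s⊆t w sw)

persistence : ∀ {I} (M : PseudoModel I) (φ : Form I) {s t : W M → Set₁}
              → t ⊆ s → M , s ⊨ φ → M , t ⊨ φ
persistence M (var i)  t⊆s (lift s⊆V)    = lift (⊆-trans t⊆s s⊆V)
persistence M ⊥'       t⊆s (lift s-empty) = lift (λ w tw → s-empty w (t⊆s w tw))
persistence M (φ ∧' ψ) t⊆s (sφ , sψ)     = persistence M φ t⊆s sφ , persistence M ψ t⊆s sψ
persistence M (φ ⇒ ψ)  t⊆s s⊨φ⇒ψ u u⊆t   = s⊨φ⇒ψ u (⊆-trans u⊆t t⊆s)
persistence M (φ ⩖ ψ)  t⊆s (inj₁ sφ)     = inj₁ (persistence M φ t⊆s sφ)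
persistence M (φ ⩖ ψ)  t⊆s (inj₂ sψ)     = inj₂ (persistence M ψ t⊆s sψ)
persistence M (□ φ)    t⊆s s⊨□φ          = λ w tw → s⊨□φ w (t⊆s w tw)
persistence M (⊞ φ)    t⊆s s⊨⊞φ          = λ w tw → s⊨⊞φ w (t⊆s w tw)

Σ⊆Σ↓ : ∀ {I} (M : PseudoModel I) {w : W M} {t : W M → Set} → Σw M w t → Σw (M ↓) w t
Σ⊆Σ↓ M {t = t} t∈Σ = t , t∈Σ , ⊆-refl

σ⊆σ↓ : ∀ {I} (M : PseudoModel I) (w : W M) → σ M w ⊆ σ (M ↓) w
σ⊆σ↓ M w v (t , t∈Σ , tv) = t , Σ⊆Σ↓ M t∈Σ , tv

σ↓⊆σ : ∀ {I} (M : PseudoModel I) (w : W M) → σ (M ↓) w ⊆ σ M w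
σ↓⊆σ M w v (t , (u , u∈Σ , t⊆u) , tv) = u , u∈Σ , t⊆u v tv

↑-mono : {W : Set} {t u : W → Set} → t ⊆ u → ↑ t ⊆ ↑ u
↑-mono t⊆u v (lift tv) = lift (t⊆u v tv)

↓-sound    : ∀ {I} (M : PseudoModel I) (φ : Form I) (s : W M → Set₁)
             → (M ↓) , s ⊨ φ → M , s ⊨ φ
↓-complete : ∀ {I} (M : PseudoModel I) (φ : Form I) (s : W M → Set₁)
             → M , s ⊨ φ → (M ↓) , s ⊨ φ

↓-sound M (var i)  s s⊨p        = s⊨p
↓-sound M ⊥'       s s⊨⊥        = s⊨⊥
↓-sound M (φ ∧' ψ) s (sφ , sψ)  = ↓-sound M φ s sφ , ↓-sound M ψ s sψ
↓-sound M (φ ⇒ ψ)  s s⊨φ⇒ψ      = λ t t⊆s tφ → ↓-sound M ψ t (s⊨φ⇒ψ t t⊆s (↓-complete M φ t tφ))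
↓-sound M (φ ⩖ ψ)  s (inj₁ sφ)  = inj₁ (↓-sound M φ s sφ)
↓-sound M (φ ⩖ ψ)  s (inj₂ sψ)  = inj₂ (↓-sound M ψ s sψ)
↓-sound M (□ φ)    s s⊨□φ       = λ w sw →
  persistence M φ (σ⊆σ↓ M w) (↓-sound M φ (σ (M ↓) w) (s⊨□φ w sw))
↓-sound M (⊞ φ)    s s⊨⊞φ       = λ w sw t t∈Σ →
  ↓-sound M φ (↑ t) (s⊨⊞φ w sw t (Σ⊆Σ↓ M t∈Σ))

↓-complete M (var i)  s s⊨p       = s⊨p
↓-complete M ⊥'       s s⊨⊥       = s⊨⊥
↓-complete M (φ ∧' ψ) s (sφ , sψ) = ↓-complete M φ s sφ , ↓-complete M ψ s sψ
↓-complete M (φ ⇒ ψ)  s s⊨φ⇒ψ     = λ t t⊆s tφ → ↓-complete M ψ t (s⊨φ⇒ψ t t⊆s (↓-sound M φ t tφ))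
↓-complete M (φ ⩖ ψ)  s (inj₁ sφ) = inj₁ (↓-complete M φ s sφ)
↓-complete M (φ ⩖ ψ)  s (inj₂ sψ) = inj₂ (↓-complete M ψ s sψ)
↓-complete M (□ φ)    s s⊨□φ      = λ w sw →
  ↓-complete M φ (σ (M ↓) w) (persistence M φ (σ↓⊆σ M w) (s⊨□φ w sw))
↓-complete M (⊞ φ)    s s⊨⊞φ      = λ w sw t (u , u∈Σ , t⊆u) →
  ↓-complete M φ (↑ t) (persistence M φ (↑-mono t⊆u) (s⊨⊞φ w sw u u∈Σ))

proposition2p6 : ∀ {I : Set} (M : PseudoModel I) (s : W M → Set₁) (φ : Form I)
                 → ((M ↓) , s ⊨ φ) ⇔ (M , s ⊨ φ)
proposition2p6 M s φ = mk⇔ (↓-sound M φ s) (↓-complete M φ s)
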